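{- Let $h\ge 2$ be an integer and let $\mathbb{N}=W_1\cup\cdots\cup W_h$ be a partition of $\mathbb{N}$ into pairwise disjoint sets such that each $W_i$ ($1\le i\le h$) is infinite, $0\in W_1$, and for every $i=2,\dots,h$ the set $W_i$ contains $\lceil \log(h+1)/\log 2\rceil$ consecutive integers. Then $A=A(W_1)\cup\cdots\cup A(W_h)$ is a minimal asymptotic basis of order $h$.
   Context: $\mathbb{N}$ denotes the set of nonnegative integers. For an integer $h\ge 2$ and $A\subseteq\mathbb{N}$, $hA=\{a_1+\cdots+a_h : a_i\in A\}$. A set $A$ is an asymptotic basis of order $h$ if every sufficiently large integer lies in $hA$; it is a minimal asymptotic basis of order $h$ if no proper subset of $A$ is an asymptotic basis of order $h$. For a nonempty $W\subseteq\mathbb{N}$, $A(W)$ denotes the set of all numbers of the form $\sum_{f\in F}2^f$ where $F$ ranges over finite nonempty subsets of $W$. -}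

module Defs where

open import Level using (0ℓ)
open import Data.Nat using (ℕ; zero; suc; _+_; _^_; _≤_; _<_)
open import Data.Nat.Logarithm using (⌈log₂_⌉)
open import Data.List using (List; []; _∷_; map)
open import Data.Nat.ListAction using (sum)
open import Data.List.Relation.Unary.All using (All)
open import Data.List.Relation.Unary.Unique.Propositional using (Unique)
import Data.Vec as Vec
open import Data.Vec using (Vec)
import Data.Vec.Relation.Unary.All as VAll
open import Data.Product using (Σ; _×_; ∃; ∃-syntax)
open import Relation.Nullary using (¬_)
open import Relation.Unary using (Pred; _⊆_)
open import Relation.Binary.PropositionalEquality using (_≡_)

ℕSet : Set₁
ℕSet = Pred ℕ 0ℓ

A⟨_⟩ : ℕSet → ℕSet
A⟨ W ⟩ n = ∃[ F ] (¬ (F ≡ [])) × Unique F × All W F × n ≡ sum (map (2 ^_) F)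

_⊕_ : ℕ → ℕSet → ℕSet
(h ⊕ A) n = ∃[ v ] (VAll.All A {h} v × Vec.sum v ≡ n)

IsAsymptoticBasis : ℕ → ℕSet → Set
IsAsymptoticBasis h A = ∃[ N ] (∀ n → N ≤ n → (h ⊕ A) n)

_⊊_ : ℕSet → ℕSet → Set
B ⊊ A = (B ⊆ A) × (∃[ a ] (A a × ¬ B a))

IsMinimalAsymptoticBasis : ℕ → ℕSet → Set₁
IsMinimalAsymptoticBasis h A =
  IsAsymptoticBasis h A × (∀ (B : ℕSet) → B ⊊ A → ¬ IsAsymptoticBasis h B)

Infinite : ℕSet → Set
Infinite W = ∀ m → ∃[ n ] (m ≤ n × W n)

ContainsConsecutive : ℕ → ℕSet → Set
ContainsConsecutive L W = ∃[ a ] (∀ t → t < L → W (a + t))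

-- ⌈log(h+1)/log 2⌉ = ⌈log₂ (h+1)⌉
clog : ℕ → ℕ
clog h = ⌈log₂ (suc h) ⌉

UnionA : ℕ → (ℕ → ℕSet) → ℕSet
UnionA h W n = ∃[ i ] ((1 ≤ i × i ≤ h) × A⟨ W i ⟩ n)

-- Write each number in binary and sort its positions into the classes W₁, …, W_h.
--
-- Basis: the positions of n lying in Wⱼ give an element of A(Wⱼ), so n is a sum of at most h
-- elements of A; as long as fewer than h summands are used and n ≥ h, some summand is ≥ 2 and
-- splits into two elements of A (2^(f+1) = 2^f + 2^f, or peel off one power of two).
--
-- Minimality: let a ∈ A(Wᵢ) and N be given.  Take n whose binary digits up to a large bound M
-- are those of a at positions in Wᵢ and 1 at every other position.  In any representation
-- n = x₁ + ⋯ + x_h with xₜ ∈ A, every class j ≠ i must occur among the xₜ: for j = 1 because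
-- bit 0 of n is 1, and for j ≥ 2 because otherwise the ⌈log₂(h+1)⌉ consecutive positions of Wⱼ
-- would be 1-digits of n produced by carries alone, which needs a carry ≥ h, while h summands
-- never carry more than h - 1.  Hence class i occurs at most once and every other class at
-- most twice, so no column addition produces a carry, the digits of the xₜ of class i are
-- exactly those of n in Wᵢ, and that xₜ is a.  Since n can be taken ≥ N, every asymptotic
-- basis contained in A must contain a.

module Submission where

open import Data.Empty using (⊥-elim)
open import Data.Fin using (Fin; zero; suc; toℕ; fromℕ<)
import Data.Fin.Properties as Finₚ
open import Data.List using (List; []; _∷_; map; length)
open import Data.List.Relation.Unary.All as All using (All; []; _∷_)
import Data.List.Relation.Unary.All.Properties as Allₚ
open import Data.List.Relation.Unary.AllPairs using ([]; _∷_)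
open import Data.List.Relation.Unary.Unique.Propositional using (Unique)
import Data.List.Relation.Unary.Unique.Propositional.Properties as Unique
open import Data.Nat using (ℕ; zero; suc; _+_; _*_; _∸_; _^_; _≤_; _<_; z≤n; s≤s; _≟_; _≤?_; _<?_; ⌊_/2⌋; ⌈_/2⌉; _⊔_)
open import Data.Nat.Induction using (<-wellFounded)
open import Data.Nat.ListAction using (sum)
open import Data.Nat.Logarithm using (⌈log₂_⌉)
open import Data.Nat.Logarithm.Core using (⌈log2⌉)
open import Data.Nat.Properties
open import Data.Nat.Tactic.RingSolver using (solve-∀)
open import Algebra.Properties.Semiring.Sum +-*-semiring using (sum-syntax; sum-cong-≗; ∑-distrib-+; *-distribˡ-sum)
open import Data.Product using (_×_; _,_; proj₁; proj₂; ∃-syntax)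
open import Data.Sum using (_⊎_; inj₁; inj₂)
import Data.Vec as Vec
import Data.Vec.Relation.Unary.All as VAll
import Data.Vec.Relation.Unary.All.Properties as VAllₚ
open import Function using (_∘_)
open import Induction.WellFounded using (Acc; acc)
open import Relation.Nullary using (¬_; yes; no)
open import Relation.Binary.PropositionalEquality using (_≡_; _≢_; refl; sym; trans; cong; cong₂; subst; subst₂; module ≡-Reasoning)

open import Defs

lsb : ℕ → ℕ
lsb zero = 0
lsb (suc zero) = 1
lsb (suc (suc n)) = lsb n

+2*suc : ∀ r q → r + 2 * suc q ≡ 2 + (r + 2 * q)
+2*suc = solve-∀

lsb+2*⌊/2⌋ : ∀ n → lsb n + 2 * ⌊ n /2⌋ ≡ n
lsb+2*⌊/2⌋ zero = refl
lsb+2*⌊/2⌋ (suc zero) = refl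
lsb+2*⌊/2⌋ (suc (suc n)) = trans (+2*suc (lsb n) ⌊ n /2⌋) (cong (2 +_) (lsb+2*⌊/2⌋ n))

2*⌊/2⌋≤ : ∀ n → 2 * ⌊ n /2⌋ ≤ n
2*⌊/2⌋≤ n = subst (2 * ⌊ n /2⌋ ≤_) (lsb+2*⌊/2⌋ n) (m≤n+m _ (lsb n))

lsb≤1 : ∀ n → lsb n ≤ 1
lsb≤1 zero = z≤n
lsb≤1 (suc zero) = s≤s z≤n
lsb≤1 (suc (suc n)) = lsb≤1 n

lsb-+2* : ∀ r q → lsb (r + 2 * q) ≡ lsb r
lsb-+2* r zero = cong lsb (+-identityʳ r)
lsb-+2* r (suc q) = trans (cong lsb (+2*suc r q)) (lsb-+2* r q)

⌊+2*/2⌋ : ∀ r q → ⌊ r + 2 * q /2⌋ ≡ ⌊ r /2⌋ + q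
⌊+2*/2⌋ r zero = trans (cong ⌊_/2⌋ (+-identityʳ r)) (sym (+-identityʳ _))
⌊+2*/2⌋ r (suc q) = trans (cong ⌊_/2⌋ (+2*suc r q)) (trans (cong suc (⌊+2*/2⌋ r q)) (sym (+-suc _ q)))

lsb-≤1 : ∀ {b} → b ≤ 1 → lsb b ≡ b
lsb-≤1 z≤n = refl
lsb-≤1 (s≤s z≤n) = refl

⌊/2⌋-≤1 : ∀ {b} → b ≤ 1 → ⌊ b /2⌋ ≡ 0
⌊/2⌋-≤1 z≤n = refl
⌊/2⌋-≤1 (s≤s z≤n) = refl

≤1⇒≡0⊎≡1 : ∀ {b} → b ≤ 1 → b ≡ 0 ⊎ b ≡ 1
≤1⇒≡0⊎≡1 z≤n = inj₁ refl
≤1⇒≡0⊎≡1 (s≤s z≤n) = inj₂ refl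

≤suc∧≢⇒≤ : ∀ {i h} → i ≤ suc h → i ≢ suc h → i ≤ h
≤suc∧≢⇒≤ i≤1+h i≢1+h = ≤-pred (≤∧≢⇒< i≤1+h i≢1+h)

shiftR : ℕ → ℕ → ℕ
shiftR zero x = x
shiftR (suc p) x = shiftR p ⌊ x /2⌋

bit : ℕ → ℕ → ℕ
bit p x = lsb (shiftR p x)

shiftR-suc : ∀ p x → shiftR (suc p) x ≡ ⌊ shiftR p x /2⌋
shiftR-suc zero x = refl
shiftR-suc (suc p) x = shiftR-suc p ⌊ x /2⌋

bit≤1 : ∀ p x → bit p x ≤ 1
bit≤1 p x = lsb≤1 (shiftR p x)

bit≢1⇒≡0 : ∀ p x → bit p x ≢ 1 → bit p x ≡ 0
bit≢1⇒≡0 p x b≢1 with ≤1⇒≡0⊎≡1 (bit≤1 p x)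
... | inj₁ b≡0 = b≡0
... | inj₂ b≡1 = ⊥-elim (b≢1 b≡1)

bit≢0⇒≡1 : ∀ p x → bit p x ≢ 0 → bit p x ≡ 1
bit≢0⇒≡1 p x b≢0 with ≤1⇒≡0⊎≡1 (bit≤1 p x)
... | inj₁ b≡0 = ⊥-elim (b≢0 b≡0)
... | inj₂ b≡1 = b≡1

bit-0 : ∀ p → bit p 0 ≡ 0
bit-0 zero = refl
bit-0 (suc p) = bit-0 p

bit≡1⇒2^≤ : ∀ p x → bit p x ≡ 1 → 2 ^ p ≤ x
bit≡1⇒2^≤ zero (suc x) _ = s≤s z≤n
bit≡1⇒2^≤ (suc p) x b = ≤-trans (*-monoʳ-≤ 2 (bit≡1⇒2^≤ p ⌊ x /2⌋ b)) (2*⌊/2⌋≤ x)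
bit≡1⇒2^≤ zero zero ()

n<2^n : ∀ n → n < 2 ^ n
n<2^n zero = s≤s z≤n
n<2^n (suc n) = +-mono-≤ (m^n>0 2 n) (subst (n <_) (sym (+-identityʳ (2 ^ n))) (n<2^n n))

bit≡1⇒< : ∀ p x → bit p x ≡ 1 → p < x
bit≡1⇒< p x b = <-≤-trans (n<2^n p) (bit≡1⇒2^≤ p x b)

≤2^⌈log₂⌉ : ∀ n → n ≤ 2 ^ ⌈log₂ n ⌉
≤2^⌈log₂⌉ n = go n (<-wellFounded n)
  where
  go : ∀ n (rec : Acc _<_ n) → n ≤ 2 ^ ⌈log2⌉ n rec
  go zero _ = z≤n
  go (suc zero) _ = s≤s z≤n
  go (suc (suc n)) (acc rs) = begin
    2 + n                        ≤⟨ +-monoʳ-≤ 2 (n≤⌈n/2⌉+⌈n/2⌉ n) ⟩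
    2 + (⌈ n /2⌉ + ⌈ n /2⌉)       ≡⟨ double (⌈ n /2⌉) ⟩
    2 * suc ⌈ n /2⌉               ≤⟨ *-monoʳ-≤ 2 (go (suc ⌈ n /2⌉) _) ⟩
    2 * 2 ^ ⌈log2⌉ (suc ⌈ n /2⌉) _ ∎
    where
    open ≤-Reasoning
    double : ∀ m → 2 + (m + m) ≡ 2 * suc m
    double = solve-∀
    n≤⌈n/2⌉+⌈n/2⌉ : ∀ n → n ≤ ⌈ n /2⌉ + ⌈ n /2⌉
    n≤⌈n/2⌉+⌈n/2⌉ n = subst (_≤ ⌈ n /2⌉ + ⌈ n /2⌉) (⌊n/2⌋+⌈n/2⌉≡n n) (+-monoˡ-≤ ⌈ n /2⌉ (⌊n/2⌋≤⌈n/2⌉ n))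

fromIsBitSequence : ℕ → (ℕ → ℕ) → ℕ
fromIsBitSequence zero e = 0
fromIsBitSequence (suc K) e = e 0 + 2 * fromIsBitSequence K (e ∘ suc)

IsBitSequence : (ℕ → ℕ) → Set
IsBitSequence e = ∀ p → e p ≤ 1

lsb-fromIsBitSequence : ∀ K e → IsBitSequence e → lsb (fromIsBitSequence (suc K) e) ≡ e 0
lsb-fromIsBitSequence K e e≤1 = trans (lsb-+2* (e 0) (fromIsBitSequence K (e ∘ suc))) (lsb-≤1 (e≤1 0))

⌊fromIsBitSequence/2⌋ : ∀ K e → IsBitSequence e → ⌊ fromIsBitSequence (suc K) e /2⌋ ≡ fromIsBitSequence K (e ∘ suc)
⌊fromIsBitSequence/2⌋ K e e≤1 = trans (⌊+2*/2⌋ (e 0) (fromIsBitSequence K (e ∘ suc))) (cong (_+ fromIsBitSequence K (e ∘ suc)) (⌊/2⌋-≤1 (e≤1 0)))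

bit-fromIsBitSequence : ∀ K e → IsBitSequence e → ∀ p → p < K → bit p (fromIsBitSequence K e) ≡ e p
bit-fromIsBitSequence (suc K) e e≤1 zero _ = lsb-fromIsBitSequence K e e≤1
bit-fromIsBitSequence (suc K) e e≤1 (suc p) (s≤s p<K) =
  trans (cong (bit p) (⌊fromIsBitSequence/2⌋ K e e≤1)) (bit-fromIsBitSequence K (e ∘ suc) (e≤1 ∘ suc) p p<K)

bit-fromIsBitSequence-≥ : ∀ K e → IsBitSequence e → ∀ p → K ≤ p → bit p (fromIsBitSequence K e) ≡ 0
bit-fromIsBitSequence-≥ zero e e≤1 p _ = bit-0 p
bit-fromIsBitSequence-≥ (suc K) e e≤1 (suc p) (s≤s K≤p) =
  trans (cong (bit p) (⌊fromIsBitSequence/2⌋ K e e≤1)) (bit-fromIsBitSequence-≥ K (e ∘ suc) (e≤1 ∘ suc) p K≤p)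

fromIsBitSequence<2^ : ∀ K e → IsBitSequence e → fromIsBitSequence K e < 2 ^ K
fromIsBitSequence<2^ zero e e≤1 = s≤s z≤n
fromIsBitSequence<2^ (suc K) e e≤1 = begin-strict
  e 0 + 2 * fromIsBitSequence K (e ∘ suc)  ≤⟨ +-monoˡ-≤ _ (e≤1 0) ⟩
  1 + 2 * fromIsBitSequence K (e ∘ suc)    <⟨ n<1+n _ ⟩
  2 + 2 * fromIsBitSequence K (e ∘ suc)    ≡⟨ *-suc 2 (fromIsBitSequence K (e ∘ suc)) ⟨
  2 * suc (fromIsBitSequence K (e ∘ suc))  ≤⟨ *-monoʳ-≤ 2 (fromIsBitSequence<2^ K (e ∘ suc) (e≤1 ∘ suc)) ⟩
  2 * 2 ^ K                       ∎
  where open ≤-Reasoning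

fromIsBitSequence-cong : ∀ K {e e′} → (∀ p → e p ≡ e′ p) → fromIsBitSequence K e ≡ fromIsBitSequence K e′
fromIsBitSequence-cong zero eq = refl
fromIsBitSequence-cong (suc K) eq = cong₂ (λ b r → b + 2 * r) (eq 0) (fromIsBitSequence-cong K (eq ∘ suc))

fromIsBitSequence-0 : ∀ K → fromIsBitSequence K (λ _ → 0) ≡ 0
fromIsBitSequence-0 zero = refl
fromIsBitSequence-0 (suc K) = cong (2 *_) (fromIsBitSequence-0 K)

fromIsBitSequence-+ : ∀ K e e′ → fromIsBitSequence K (λ p → e p + e′ p) ≡ fromIsBitSequence K e + fromIsBitSequence K e′
fromIsBitSequence-+ zero e e′ = refl
fromIsBitSequence-+ (suc K) e e′ = begin
  e 0 + e′ 0 + 2 * fromIsBitSequence K (λ p → e (suc p) + e′ (suc p))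
    ≡⟨ cong (λ r → e 0 + e′ 0 + 2 * r) (fromIsBitSequence-+ K (e ∘ suc) (e′ ∘ suc)) ⟩
  e 0 + e′ 0 + 2 * (fromIsBitSequence K (e ∘ suc) + fromIsBitSequence K (e′ ∘ suc))
    ≡⟨ interchange (e 0) (e′ 0) (fromIsBitSequence K (e ∘ suc)) (fromIsBitSequence K (e′ ∘ suc)) ⟩
  e 0 + 2 * fromIsBitSequence K (e ∘ suc) + (e′ 0 + 2 * fromIsBitSequence K (e′ ∘ suc)) ∎
  where
  open ≡-Reasoning
  interchange : ∀ a b c d → a + b + 2 * (c + d) ≡ a + 2 * c + (b + 2 * d)
  interchange = solve-∀

fromIsBitSequence-bit : ∀ K x → x ≤ K → fromIsBitSequence K (λ p → bit p x) ≡ x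
fromIsBitSequence-bit zero zero z≤n = refl
fromIsBitSequence-bit (suc K) x x≤1+K = begin
  lsb x + 2 * fromIsBitSequence K (λ p → bit p ⌊ x /2⌋)  ≡⟨ cong (λ r → lsb x + 2 * r) (fromIsBitSequence-bit K ⌊ x /2⌋ ⌊x/2⌋≤K) ⟩
  lsb x + 2 * ⌊ x /2⌋                           ≡⟨ lsb+2*⌊/2⌋ x ⟩
  x                                             ∎
  where
  open ≡-Reasoning
  ⌊x/2⌋≤K : ⌊ x /2⌋ ≤ K
  ⌊x/2⌋≤K = ≤-pred (≤-<-trans (⌊n/2⌋-mono x≤1+K) (⌊n/2⌋<n K))

bit-injective : ∀ {x y} → (∀ p → bit p x ≡ bit p y) → x ≡ y
bit-injective {x} {y} eq = begin
  x                                 ≡⟨ fromIsBitSequence-bit (x + y) x (m≤m+n x y) ⟨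
  fromIsBitSequence (x + y) (λ p → bit p x)  ≡⟨ fromIsBitSequence-cong (x + y) eq ⟩
  fromIsBitSequence (x + y) (λ p → bit p y)  ≡⟨ fromIsBitSequence-bit (x + y) y (m≤n+m y x) ⟩
  y                                 ∎
  where open ≡-Reasoning

nonzero⇒bit≡1 : ∀ x → x ≢ 0 → ∃[ p ] bit p x ≡ 1
nonzero⇒bit≡1 x x≢0 with Finₚ.any? (λ (k : Fin x) → bit (toℕ k) x ≟ 1)
... | yes (k , b) = toℕ k , b
... | no none = ⊥-elim (x≢0 (bit-injective λ p → trans (bit≢1⇒≡0 p x (no-bit p)) (sym (bit-0 p))))
  where
  no-bit : ∀ p → bit p x ≢ 1
  no-bit p b = none (fromℕ< p<x , subst (λ q → bit q x ≡ 1) (sym (Finₚ.toℕ-fromℕ< p<x)) b)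
    where p<x = bit≡1⇒< p x b

∑2^ : List ℕ → ℕ
∑2^ F = sum (map (2 ^_) F)

⌊suc/2⌋ : ∀ y → lsb y ≡ 0 → ⌊ suc y /2⌋ ≡ ⌊ y /2⌋
⌊suc/2⌋ zero _ = refl
⌊suc/2⌋ (suc (suc y)) lsb≡0 = cong suc (⌊suc/2⌋ y lsb≡0)

bit-2^+ : ∀ f q y → bit f y ≡ 0 → bit q (2 ^ f + y) ≡ 1 → q ≡ f ⊎ bit q y ≡ 1
bit-2^+ zero zero y _ _ = inj₁ refl
bit-2^+ zero (suc q) y lsb≡0 b = inj₂ (subst (λ z → bit q z ≡ 1) (⌊suc/2⌋ y lsb≡0) b)
bit-2^+ (suc f) zero y _ b = inj₂ (trans (sym (trans (cong lsb (+-comm (2 ^ suc f) y)) (lsb-+2* y (2 ^ f)))) b)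
bit-2^+ (suc f) (suc q) y bf≡0 b with bit-2^+ f q ⌊ y /2⌋ bf≡0 (subst (λ z → bit q z ≡ 1) ⌊2^+/2⌋ b)
  where
  ⌊2^+/2⌋ : ⌊ 2 ^ suc f + y /2⌋ ≡ 2 ^ f + ⌊ y /2⌋
  ⌊2^+/2⌋ = trans (cong ⌊_/2⌋ (+-comm (2 ^ suc f) y)) (trans (⌊+2*/2⌋ y (2 ^ f)) (+-comm ⌊ y /2⌋ (2 ^ f)))
... | inj₁ q≡f = inj₁ (cong suc q≡f)
... | inj₂ b′ = inj₂ b′

bit-∑2^ : ∀ {P : ℕ → Set} {F} → Unique F → All P F → ∀ q → bit q (∑2^ F) ≡ 1 → P q
bit-∑2^ {F = []} _ _ q b = ⊥-elim (0≢1+n (trans (sym (bit-0 q)) b))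
bit-∑2^ {P} {f ∷ F} (f∉F ∷ uF) (pf ∷ pF) q b with bit-2^+ f q (∑2^ F) bf≡0 b
  where
  -- f ∉ F is itself an All-predicate on F, so the lemma applies to it
  bf≡0 : bit f (∑2^ F) ≡ 0
  bf≡0 = bit≢1⇒≡0 f (∑2^ F) (λ bf → bit-∑2^ uF f∉F f bf refl)
... | inj₁ refl = pf
... | inj₂ b′ = bit-∑2^ uF pF q b′

A⇒bits : ∀ {W x} → A⟨ W ⟩ x → x ≢ 0 × (∀ q → bit q x ≡ 1 → W q)
A⇒bits ([] , F≢[] , _) = ⊥-elim (F≢[] refl)
A⇒bits (f ∷ F , _ , uF , WF , refl) =
  (λ x≡0 → <⇒≢ (m^n>0 2 f) (sym (m+n≡0⇒m≡0 (2 ^ f) x≡0))) , (λ q b → bit-∑2^ uF WF q b)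

consIfNonzero : ℕ → ℕ → List ℕ → List ℕ
consIfNonzero zero _ l = l
consIfNonzero (suc _) y l = y ∷ l

consIfNonzero⁺ : ∀ {P : ℕ → Set} b {y l} → (b ≢ 0 → P y) → All P l → All P (consIfNonzero b y l)
consIfNonzero⁺ zero _ pl = pl
consIfNonzero⁺ (suc b) py pl = py (λ ()) ∷ pl

support : ℕ → (ℕ → ℕ) → List ℕ
support zero e = []
support (suc K) e = consIfNonzero (e 0) 0 (map suc (support K (e ∘ suc)))

∑2^-map-suc : ∀ l → ∑2^ (map suc l) ≡ 2 * ∑2^ l
∑2^-map-suc [] = refl
∑2^-map-suc (f ∷ l) = trans (cong (2 ^ suc f +_) (∑2^-map-suc l)) (sym (*-distribˡ-+ 2 (2 ^ f) (∑2^ l)))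

∑2^-support : ∀ K e → IsBitSequence e → ∑2^ (support K e) ≡ fromIsBitSequence K e
∑2^-support zero e e≤1 = refl
∑2^-support (suc K) e e≤1 = begin
  ∑2^ (consIfNonzero (e 0) 0 (map suc l))  ≡⟨ ∑2^-consIfNonzero (e≤1 0) ⟩
  e 0 + ∑2^ (map suc l)                    ≡⟨ cong (e 0 +_) (∑2^-map-suc l) ⟩
  e 0 + 2 * ∑2^ l                          ≡⟨ cong (λ r → e 0 + 2 * r) (∑2^-support K (e ∘ suc) (e≤1 ∘ suc)) ⟩
  e 0 + 2 * fromIsBitSequence K (e ∘ suc)           ∎
  where
  open ≡-Reasoning
  l = support K (e ∘ suc)
  ∑2^-consIfNonzero : ∀ {b} → b ≤ 1 → ∑2^ (consIfNonzero b 0 (map suc l)) ≡ b + ∑2^ (map suc l)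
  ∑2^-consIfNonzero z≤n = refl
  ∑2^-consIfNonzero (s≤s z≤n) = refl

support-nonzero : ∀ K e → All (λ p → e p ≢ 0) (support K e)
support-nonzero zero e = []
support-nonzero (suc K) e = consIfNonzero⁺ (e 0) (λ e0≢0 → e0≢0) (Allₚ.map⁺ (support-nonzero K (e ∘ suc)))

support-unique : ∀ K e → Unique (support K e)
support-unique zero e = []
support-unique (suc K) e = consIfNonzero-unique (e 0) (Unique.map⁺ suc-injective (support-unique K (e ∘ suc)))
  where
  consIfNonzero-unique : ∀ b {l} → Unique (map suc l) → Unique (consIfNonzero b 0 (map suc l))
  consIfNonzero-unique zero u = u
  consIfNonzero-unique (suc b) {l} u = Allₚ.map⁺ (All.universal (λ _ ()) l) ∷ u

bits⇒A : ∀ {W : ℕSet} {x} → x ≢ 0 → (∀ q → bit q x ≡ 1 → W q) → A⟨ W ⟩ x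
bits⇒A {W} {x} x≢0 bits∈W = support x bits , support≢[] , support-unique x bits ,
  All.map (λ {q} b≢0 → bits∈W q (bit≢0⇒≡1 q x b≢0)) (support-nonzero x bits) , sym ∑2^-support-bits
  where
  bits : ℕ → ℕ
  bits p = bit p x
  ∑2^-support-bits : ∑2^ (support x bits) ≡ x
  ∑2^-support-bits = trans (∑2^-support x bits (λ p → bit≤1 p x)) (fromIsBitSequence-bit x x ≤-refl)
  support≢[] : support x bits ≢ []
  support≢[] eq = x≢0 (trans (sym ∑2^-support-bits) (cong ∑2^ eq))

∑-mono-≤ : ∀ {n} {f g : Fin n → ℕ} → (∀ t → f t ≤ g t) → ∑[ t < n ] f t ≤ ∑[ t < n ] g t
∑-mono-≤ {zero} _ = z≤n
∑-mono-≤ {suc n} f≤g = +-mono-≤ (f≤g zero) (∑-mono-≤ (f≤g ∘ suc))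

∑-≤1 : ∀ {n} {f : Fin n → ℕ} → (∀ t → f t ≤ 1) → ∑[ t < n ] f t ≤ n
∑-≤1 {zero} _ = z≤n
∑-≤1 {suc n} f≤1 = +-mono-≤ (f≤1 zero) (∑-≤1 (f≤1 ∘ suc))

≤∑ : ∀ {n} (f : Fin n → ℕ) t → f t ≤ ∑[ s < n ] f s
≤∑ f zero = m≤m+n (f zero) _
≤∑ f (suc t) = ≤-trans (≤∑ (f ∘ suc) t) (m≤n+m _ (f zero))

+≤∑ : ∀ {n} (f : Fin n → ℕ) {t t′} → t ≢ t′ → f t + f t′ ≤ ∑[ s < n ] f s
+≤∑ f {zero} {zero} t≢t′ = ⊥-elim (t≢t′ refl)
+≤∑ f {zero} {suc t′} _ = +-monoʳ-≤ (f zero) (≤∑ (f ∘ suc) t′)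
+≤∑ f {suc t} {zero} _ = subst (_≤ ∑[ s < _ ] f s) (+-comm (f zero) (f (suc t))) (+-monoʳ-≤ (f zero) (≤∑ (f ∘ suc) t))
+≤∑ f {suc t} {suc t′} t≢t′ = ≤-trans (+≤∑ (f ∘ suc) (t≢t′ ∘ cong suc)) (m≤n+m _ (f zero))

∑≢0 : ∀ {n} (f : Fin n → ℕ) → ∑[ t < n ] f t ≢ 0 → ∃[ t ] f t ≢ 0
∑≢0 {zero} f s≢0 = ⊥-elim (s≢0 refl)
∑≢0 {suc n} f s≢0 with f zero ≟ 0
... | no f0≢0 = zero , f0≢0
... | yes f0≡0 with ∑≢0 (f ∘ suc) (λ s≡0 → s≢0 (cong₂ _+_ f0≡0 s≡0))
... | t , ft≢0 = suc t , ft≢0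

∑-0 : ∀ {n} {f : Fin n → ℕ} → (∀ t → f t ≡ 0) → ∑[ t < n ] f t ≡ 0
∑-0 {zero} _ = refl
∑-0 {suc n} f≡0 = cong₂ _+_ (f≡0 zero) (∑-0 (f≡0 ∘ suc))

module ColumnAddition {h : ℕ} (xs : Fin h → ℕ) where

  total : ℕ
  total = ∑[ t < h ] xs t

  colSum : ℕ → ℕ
  colSum p = ∑[ t < h ] bit p (xs t)

  carry : ℕ → ℕ
  carry zero = 0
  carry (suc p) = ⌊ colSum p + carry p /2⌋

  private
    rest : ℕ → ℕ
    rest p = ∑[ t < h ] ⌊ shiftR p (xs t) /2⌋

    ∑shiftR≡ : ∀ p → ∑[ t < h ] shiftR p (xs t) ≡ colSum p + 2 * rest p
    ∑shiftR≡ p = begin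
      ∑[ t < h ] shiftR p (xs t)                                 ≡⟨ sum-cong-≗ (λ t → sym (lsb+2*⌊/2⌋ (shiftR p (xs t)))) ⟩
      ∑[ t < h ] (bit p (xs t) + 2 * ⌊ shiftR p (xs t) /2⌋)      ≡⟨ ∑-distrib-+ (λ t → bit p (xs t)) _ ⟩
      colSum p + ∑[ t < h ] (2 * ⌊ shiftR p (xs t) /2⌋)          ≡⟨ cong (colSum p +_) (*-distribˡ-sum 2 (λ t → ⌊ shiftR p (xs t) /2⌋)) ⟨
      colSum p + 2 * rest p                                      ∎
      where open ≡-Reasoning

    swap : ∀ a b c → a + 2 * b + c ≡ a + c + 2 * b
    swap = solve-∀

  colSum+carry : ∀ p → colSum p + carry p + 2 * rest p ≡ shiftR p total

  ∑shiftR+carry : ∀ p → ∑[ t < h ] shiftR p (xs t) + carry p ≡ shiftR p total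
  ∑shiftR+carry zero = +-identityʳ total
  ∑shiftR+carry (suc p) = begin
    ∑[ t < h ] shiftR (suc p) (xs t) + carry (suc p)     ≡⟨ cong (_+ carry (suc p)) (sum-cong-≗ (λ t → shiftR-suc p (xs t))) ⟩
    rest p + ⌊ colSum p + carry p /2⌋                    ≡⟨ +-comm (rest p) _ ⟩
    ⌊ colSum p + carry p /2⌋ + rest p                    ≡⟨ ⌊+2*/2⌋ (colSum p + carry p) (rest p) ⟨
    ⌊ colSum p + carry p + 2 * rest p /2⌋                ≡⟨ cong ⌊_/2⌋ (colSum+carry p) ⟩
    ⌊ shiftR p total /2⌋                                 ≡⟨ shiftR-suc p total ⟨
    shiftR (suc p) total                                 ∎
    where open ≡-Reasoning

  colSum+carry p = trans (sym (swap (colSum p) (rest p) (carry p)))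
                         (trans (cong (_+ carry p) (sym (∑shiftR≡ p))) (∑shiftR+carry p))

  bit-total : ∀ p → bit p total ≡ lsb (colSum p + carry p)
  bit-total p = trans (cong lsb (sym (colSum+carry p))) (lsb-+2* (colSum p + carry p) (rest p))

  carry< : 1 ≤ h → ∀ p → carry p < h
  carry< 1≤h zero = 1≤h
  carry< 1≤h (suc p) = *-cancelˡ-< 2 _ _ (begin-strict
    2 * ⌊ colSum p + carry p /2⌋  ≤⟨ 2*⌊/2⌋≤ (colSum p + carry p) ⟩
    colSum p + carry p            <⟨ +-mono-≤-< (∑-≤1 (λ t → bit≤1 p (xs t))) (carry< 1≤h p) ⟩
    h + h                         ≡⟨ cong (h +_) (+-identityʳ h) ⟨
    2 * h                         ∎)
    where open ≤-Reasoning

  -- A column with no digits but a 1 in the total must be paid for by an odd carry, which halves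
  -- at the next column; so a run of L such columns needs an incoming carry of at least 2^L - 1.
  run⇒2^≤carry : ∀ L u → (∀ s → s < L → colSum (u + s) ≡ 0 × bit (u + s) total ≡ 1) →
                 2 ^ L ≤ suc (carry u)
  run⇒2^≤carry zero u _ = s≤s z≤n
  run⇒2^≤carry (suc L) u run = begin
    2 * 2 ^ L                       ≤⟨ *-monoʳ-≤ 2 (run⇒2^≤carry L (suc u) run′) ⟩
    2 * suc (carry (suc u))         ≡⟨ cong (λ c → 2 * suc ⌊ c + carry u /2⌋) colSum≡0 ⟩
    2 * suc ⌊ carry u /2⌋           ≡⟨ *-suc 2 ⌊ carry u /2⌋ ⟩
    1 + (1 + 2 * ⌊ carry u /2⌋)     ≡⟨ cong (λ b → 1 + (b + 2 * ⌊ carry u /2⌋)) lsb≡1 ⟨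
    1 + (lsb (carry u) + 2 * ⌊ carry u /2⌋)  ≡⟨ cong suc (lsb+2*⌊/2⌋ (carry u)) ⟩
    suc (carry u)                   ∎
    where
    open ≤-Reasoning
    run′ : ∀ s → s < L → colSum (suc u + s) ≡ 0 × bit (suc u + s) total ≡ 1
    run′ s s<L = subst (λ q → colSum q ≡ 0 × bit q total ≡ 1) (+-suc u s) (run (suc s) (s≤s s<L))
    colSum≡0 : colSum u ≡ 0
    colSum≡0 = subst (λ q → colSum q ≡ 0) (+-identityʳ u) (proj₁ (run 0 (s≤s z≤n)))
    lsb≡1 : lsb (carry u) ≡ 1
    lsb≡1 = begin-equality
      lsb (carry u)               ≡⟨ cong (λ c → lsb (c + carry u)) colSum≡0 ⟨
      lsb (colSum u + carry u)    ≡⟨ bit-total u ⟨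
      bit u total                 ≡⟨ subst (λ q → bit q total ≡ 1) (+-identityʳ u) (proj₂ (run 0 (s≤s z≤n))) ⟩
      1                           ∎

  noCarry : (∀ p → carry p ≡ 0 → colSum p ≤ 1) → ∀ p → carry p ≡ 0
  noCarry small zero = refl
  noCarry small (suc p) = begin-equality
    ⌊ colSum p + carry p /2⌋  ≡⟨ cong (λ c → ⌊ colSum p + c /2⌋) (noCarry small p) ⟩
    ⌊ colSum p + 0 /2⌋        ≡⟨ cong ⌊_/2⌋ (+-identityʳ (colSum p)) ⟩
    ⌊ colSum p /2⌋            ≡⟨ ⌊/2⌋-≤1 (small p (noCarry small p)) ⟩
    0                         ∎
    where open ≤-Reasoning

  noCarry⇒colSum≡bit : (∀ p → carry p ≡ 0 → colSum p ≤ 1) → ∀ p → colSum p ≡ bit p total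
  noCarry⇒colSum≡bit small p = begin
    colSum p                  ≡⟨ lsb-≤1 (small p carry≡0) ⟨
    lsb (colSum p)            ≡⟨ cong lsb (+-identityʳ (colSum p)) ⟨
    lsb (colSum p + 0)        ≡⟨ cong (λ c → lsb (colSum p + c)) carry≡0 ⟨
    lsb (colSum p + carry p)  ≡⟨ bit-total p ⟨
    bit p total               ∎
    where
    open ≡-Reasoning
    carry≡0 = noCarry small p

sum₁ : ℕ → (ℕ → ℕ) → ℕ
sum₁ zero f = 0
sum₁ (suc h) f = sum₁ h f + f (suc h)

sum₁-∑ : ∀ h {n} (g : Fin n → ℕ → ℕ) → sum₁ h (λ k → ∑[ t < n ] g t k) ≡ ∑[ t < n ] sum₁ h (g t)
sum₁-∑ zero {n} g = sym (∑-0 {n} {λ _ → 0} (λ _ → refl))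
sum₁-∑ (suc h) g = trans (cong (_+ ∑[ t < _ ] g t (suc h)) (sum₁-∑ h g)) (sym (∑-distrib-+ (λ t → sum₁ h (g t)) _))

fromIsBitSequence-sum₁ : ∀ K h (e : ℕ → ℕ → ℕ) → fromIsBitSequence K (λ p → sum₁ h (λ j → e j p)) ≡ sum₁ h (λ j → fromIsBitSequence K (e j))
fromIsBitSequence-sum₁ K zero e = fromIsBitSequence-0 K
fromIsBitSequence-sum₁ K (suc h) e = trans (fromIsBitSequence-+ K _ (e (suc h))) (cong (_+ fromIsBitSequence K (e (suc h))) (fromIsBitSequence-sum₁ K h e))

onlyAt : ℕ → ℕ → ℕ → ℕ
onlyAt x c k with x ≟ k
... | yes _ = c
... | no _ = 0

onlyAt-self : ∀ x c → onlyAt x c x ≡ c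
onlyAt-self x c with x ≟ x
... | yes _ = refl
... | no x≢x = ⊥-elim (x≢x refl)

onlyAt≢0 : ∀ x c k → onlyAt x c k ≢ 0 → x ≡ k
onlyAt≢0 x c k v≢0 with x ≟ k
... | yes x≡k = x≡k
... | no _ = ⊥-elim (v≢0 refl)

onlyAt-≤ : ∀ x {c} k → c ≤ 1 → onlyAt x c k ≤ 1
onlyAt-≤ x k c≤1 with x ≟ k
... | yes _ = c≤1
... | no _ = z≤n

sum₁-onlyAt : ∀ h x c → 1 ≤ x → x ≤ h → sum₁ h (onlyAt x c) ≡ c
sum₁-onlyAt zero zero c () _
sum₁-onlyAt zero (suc x) c _ ()
sum₁-onlyAt (suc h) x c 1≤x x≤1+h with x ≟ suc h
... | yes refl = cong (_+ c) (sum₁-onlyAt-> h ≤-refl)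
  where
  sum₁-onlyAt-> : ∀ h′ → h′ < x → sum₁ h′ (onlyAt x c) ≡ 0
  sum₁-onlyAt-> zero _ = refl
  sum₁-onlyAt-> (suc h′) h′<x with x ≟ suc h′
  ... | yes refl = ⊥-elim (<-irrefl refl h′<x)
  ... | no _ = trans (+-identityʳ _) (sum₁-onlyAt-> h′ (<-trans (n<1+n h′) h′<x))
... | no x≢1+h = trans (+-identityʳ _) (sum₁-onlyAt h x c 1≤x (≤-pred (≤∧≢⇒< x≤1+h x≢1+h)))

sum₁-≥ : ∀ h f → (∀ k → 1 ≤ k → k ≤ h → 1 ≤ f k) → h ≤ sum₁ h f
sum₁-≥ zero f _ = z≤n
sum₁-≥ (suc h) f pos =
  subst (_≤ sum₁ (suc h) f) (+-comm h 1) (+-mono-≤ (sum₁-≥ h f (λ k 1≤k k≤h → pos k 1≤k (m≤n⇒m≤1+n k≤h))) (pos (suc h) (s≤s z≤n) ≤-refl))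

+1+[1+]≡+2 : ∀ a b → a + 1 + (1 + b) ≡ a + b + 2
+1+[1+]≡+2 = solve-∀

sum₁-≥-except₁ : ∀ h f i → 1 ≤ i → i ≤ h → (∀ k → 1 ≤ k → k ≤ h → k ≢ i → 1 ≤ f k) →
                 h + f i ≤ sum₁ h f + 1
sum₁-≥-except₁ zero f zero () _ _
sum₁-≥-except₁ zero f (suc i) _ () _
sum₁-≥-except₁ (suc h) f i 1≤i i≤1+h pos with i ≟ suc h
... | yes refl = subst (_≤ sum₁ h f + f i + 1) (+-comm (h + f i) 1)
  (+-monoˡ-≤ 1 (+-monoˡ-≤ (f i) (sum₁-≥ h f (λ k 1≤k k≤h → pos k 1≤k (m≤n⇒m≤1+n k≤h) (<⇒≢ (s≤s k≤h))))))
... | no i≢1+h = subst₂ _≤_ (+-comm (h + f i) 1) (shuffle (sum₁ h f) 1 (f (suc h)))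
  (+-mono-≤ (sum₁-≥-except₁ h f i 1≤i (≤suc∧≢⇒≤ i≤1+h i≢1+h) (λ k 1≤k k≤h → pos k 1≤k (m≤n⇒m≤1+n k≤h))) (pos (suc h) (s≤s z≤n) ≤-refl (i≢1+h ∘ sym)))
  where
  shuffle : ∀ a b c → a + b + c ≡ a + c + b
  shuffle = solve-∀

sum₁-≥-except₂ : ∀ h f i j → i ≢ j → 1 ≤ i → i ≤ h → 1 ≤ j → j ≤ h →
                 (∀ k → 1 ≤ k → k ≤ h → k ≢ i → k ≢ j → 1 ≤ f k) →
                 h + (f i + f j) ≤ sum₁ h f + 2
sum₁-≥-except₂ zero f zero j _ () _ _ _ _
sum₁-≥-except₂ zero f (suc i) j _ _ () _ _ _
sum₁-≥-except₂ (suc h) f i j i≢j 1≤i i≤1+h 1≤j j≤1+h pos with i ≟ suc h | j ≟ suc h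
... | yes refl | yes refl = ⊥-elim (i≢j refl)
... | yes refl | no j≢1+h = subst₂ _≤_ (shuffleˡ h (f i) (f j)) (+1+[1+]≡+2 (sum₁ h f) (f i))
  (+-monoˡ-≤ (1 + f i) (sum₁-≥-except₁ h f j 1≤j (≤suc∧≢⇒≤ j≤1+h j≢1+h)
    (λ k 1≤k k≤h k≢j → pos k 1≤k (m≤n⇒m≤1+n k≤h) (<⇒≢ (s≤s k≤h)) k≢j)))
  where
  shuffleˡ : ∀ a b c → a + c + (1 + b) ≡ suc a + (b + c)
  shuffleˡ = solve-∀
... | no i≢1+h | yes refl = subst₂ _≤_ (shuffleˡ h (f i) (f j)) (+1+[1+]≡+2 (sum₁ h f) (f j))
  (+-monoˡ-≤ (1 + f j) (sum₁-≥-except₁ h f i 1≤i (≤suc∧≢⇒≤ i≤1+h i≢1+h)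
    (λ k 1≤k k≤h k≢i → pos k 1≤k (m≤n⇒m≤1+n k≤h) k≢i (<⇒≢ (s≤s k≤h)))))
  where
  shuffleˡ : ∀ a b c → a + b + (1 + c) ≡ suc a + (b + c)
  shuffleˡ = solve-∀
... | no i≢1+h | no j≢1+h = subst₂ _≤_ (+-comm (h + (f i + f j)) 1) (shuffle (sum₁ h f) 2 (f (suc h)))
  (+-mono-≤ (sum₁-≥-except₂ h f i j i≢j 1≤i (≤suc∧≢⇒≤ i≤1+h i≢1+h) 1≤j (≤suc∧≢⇒≤ j≤1+h j≢1+h)
               (λ k 1≤k k≤h → pos k 1≤k (m≤n⇒m≤1+n k≤h)))
            (pos (suc h) (s≤s z≤n) ≤-refl (i≢1+h ∘ sym) (j≢1+h ∘ sym)))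
  where
  shuffle : ∀ a b c → a + b + c ≡ a + c + b
  shuffle = solve-∀

list⇒⊕ : ∀ {A : ℕSet} h ys → length ys ≡ h → All A ys → (h ⊕ A) (sum ys)
list⇒⊕ zero [] refl [] = Vec.[] , VAll.[] , refl
list⇒⊕ (suc h) (y ∷ ys) refl (ay ∷ ays) with list⇒⊕ h ys refl ays
... | v , av , sum≡ = y Vec.∷ v , ay VAll.∷ av , cong (y +_) sum≡

module Refinement {A : ℕSet} (A≢0 : ∀ {x} → A x → x ≢ 0)
  (split : ∀ {x} → A x → 2 ≤ x → ∃[ y ] ∃[ z ] (A y × A z × y + z ≡ x)) where

  refineOnce : ∀ xs → All A xs → length xs < sum xs →
               ∃[ ys ] (All A ys × length ys ≡ suc (length xs) × sum ys ≡ sum xs)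
  refineOnce (x ∷ xs) (ax ∷ axs) len<sum with 2 ≤? x
  ... | yes 2≤x with split ax 2≤x
  ...   | y , z , ay , az , y+z≡x = y ∷ z ∷ xs , ay ∷ az ∷ axs , refl , trans (sym (+-assoc y z (sum xs))) (cong (_+ sum xs) y+z≡x)
  refineOnce (x ∷ xs) (ax ∷ axs) len<sum | no 2≰x with refineOnce xs axs (≤-pred (subst (λ x → suc (length xs) < x + sum xs) x≡1 len<sum))
    where
    x≡1 : x ≡ 1
    x≡1 = ≤-antisym (≤-pred (≰⇒> 2≰x)) (n≢0⇒n>0 (A≢0 ax))
  ...   | ys , ays , len≡ , sum≡ = x ∷ ys , ax ∷ ays , cong suc len≡ , cong (x +_) sum≡

  refineBy : ∀ {h} d xs → All A xs → length xs + d ≡ h → h ≤ sum xs →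
             ∃[ ys ] (All A ys × length ys ≡ h × sum ys ≡ sum xs)
  refineBy zero xs axs len≡ _ = xs , axs , trans (sym (+-identityʳ _)) len≡ , refl
  refineBy {h} (suc d) xs axs len+d≡h h≤sum with refineOnce xs axs (<-≤-trans len<h h≤sum)
    where
    len<h = subst (length xs <_) len+d≡h (m<m+n (length xs) (s≤s z≤n))
  ... | ys , ays , len≡ , sum≡ with refineBy d ys ays (trans (cong (_+ d) len≡) (trans (sym (+-suc _ d)) len+d≡h)) (subst (h ≤_) (sym sum≡) h≤sum)
  ... | zs , azs , len≡′ , sum≡′ = zs , azs , len≡′ , trans sum≡′ sum≡

  refine : ∀ {h} xs → All A xs → length xs ≤ h → h ≤ sum xs → (h ⊕ A) (sum xs)
  refine {h} xs axs len≤h h≤sum with refineBy (h ∸ length xs) xs axs (m+[n∸m]≡n len≤h) h≤sum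
  ... | ys , ays , len≡ , sum≡ = subst (h ⊕ A) sum≡ (list⇒⊕ h ys len≡ ays)

module Partition {h : ℕ} {W : ℕ → ℕSet} (cover : ∀ n → ∃[ i ] ((1 ≤ i × i ≤ h) × W i n)) where

  class : ℕ → ℕ
  class p = proj₁ (cover p)

  1≤class : ∀ p → 1 ≤ class p
  1≤class p = proj₁ (proj₁ (proj₂ (cover p)))

  class≤h : ∀ p → class p ≤ h
  class≤h p = proj₂ (proj₁ (proj₂ (cover p)))

  W-class : ∀ p → W (class p) p
  W-class p = proj₂ (proj₂ (cover p))

  2^∈A : ∀ f → UnionA h W (2 ^ f)
  2^∈A f = class f , (1≤class f , class≤h f) , f ∷ [] , (λ ()) , [] ∷ [] , W-class f ∷ [] , sym (+-identityʳ (2 ^ f))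

  A≢0 : ∀ {x} → UnionA h W x → x ≢ 0
  A≢0 (_ , _ , x∈Aᵢ) = proj₁ (A⇒bits x∈Aᵢ)

  splitA : ∀ {x} → UnionA h W x → 2 ≤ x → ∃[ y ] ∃[ z ] (UnionA h W y × UnionA h W z × y + z ≡ x)
  splitA (_ , _ , [] , F≢[] , _) _ = ⊥-elim (F≢[] refl)
  splitA (_ , _ , zero ∷ [] , _ , _ , _ , refl) (s≤s ())
  splitA (_ , _ , suc f ∷ [] , _ , _ , _ , refl) _ =
    2 ^ f , 2 ^ f , 2^∈A f , 2^∈A f , trans (cong (2 ^ f +_) (sym (+-identityʳ (2 ^ f)))) (sym (+-identityʳ _))
  splitA (i , i∈ , f ∷ g ∷ F , _ , _ ∷ uF , wf ∷ wF , refl) _ =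
    2 ^ f , ∑2^ (g ∷ F) , (i , i∈ , f ∷ [] , (λ ()) , [] ∷ [] , wf ∷ [] , sym (+-identityʳ _)) ,
    (i , i∈ , g ∷ F , (λ ()) , uF , wF , refl) , refl

  classPart : ℕ → ℕ → ℕ
  classPart n j = fromIsBitSequence n (λ p → onlyAt (class p) (bit p n) j)

  classPart∈A : ∀ n j → 1 ≤ j → j ≤ h → classPart n j ≢ 0 → UnionA h W (classPart n j)
  classPart∈A n j 1≤j j≤h part≢0 = j , (1≤j , j≤h) , bits⇒A part≢0 bits∈Wⱼ
    where
    digits≤1 : IsBitSequence (λ p → onlyAt (class p) (bit p n) j)
    digits≤1 p = onlyAt-≤ (class p) j (bit≤1 p n)
    bits∈Wⱼ : ∀ q → bit q (classPart n j) ≡ 1 → W j q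
    bits∈Wⱼ q b with q <? n
    ... | yes q<n = subst (λ k → W k q) (onlyAt≢0 (class q) (bit q n) j (λ d≡0 → 0≢1+n (trans (sym d≡0) (trans (sym (bit-fromIsBitSequence n _ digits≤1 q q<n)) b)))) (W-class q)
    ... | no q≮n = ⊥-elim (0≢1+n (trans (sym (bit-fromIsBitSequence-≥ n _ digits≤1 q (≮⇒≥ q≮n))) b))

  sum₁-classPart : ∀ n → sum₁ h (classPart n) ≡ n
  sum₁-classPart n = begin
    sum₁ h (classPart n)                                         ≡⟨ fromIsBitSequence-sum₁ n h (λ j p → onlyAt (class p) (bit p n) j) ⟨
    fromIsBitSequence n (λ p → sum₁ h (onlyAt (class p) (bit p n)))       ≡⟨ fromIsBitSequence-cong n (λ p → sum₁-onlyAt h (class p) (bit p n) (1≤class p) (class≤h p)) ⟩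
    fromIsBitSequence n (λ p → bit p n)                                   ≡⟨ fromIsBitSequence-bit n n ≤-refl ⟩
    n                                                            ∎
    where open ≡-Reasoning

  nonzeroParts : ℕ → ℕ → List ℕ
  nonzeroParts n zero = []
  nonzeroParts n (suc j) = consIfNonzero (classPart n (suc j)) (classPart n (suc j)) (nonzeroParts n j)

  sum-nonzeroParts : ∀ n j → sum (nonzeroParts n j) ≡ sum₁ j (classPart n)
  sum-nonzeroParts n zero = refl
  sum-nonzeroParts n (suc j) = trans (sum-consIfNonzero (classPart n (suc j))) (trans (cong (classPart n (suc j) +_) (sum-nonzeroParts n j)) (+-comm (classPart n (suc j)) (sum₁ j (classPart n))))
    where
    sum-consIfNonzero : ∀ x → sum (consIfNonzero x x (nonzeroParts n j)) ≡ x + sum (nonzeroParts n j)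
    sum-consIfNonzero zero = refl
    sum-consIfNonzero (suc x) = refl

  length-nonzeroParts : ∀ n j → length (nonzeroParts n j) ≤ j
  length-nonzeroParts n zero = z≤n
  length-nonzeroParts n (suc j) = length-consIfNonzero (classPart n (suc j))
    where
    length-consIfNonzero : ∀ x → length (consIfNonzero x x (nonzeroParts n j)) ≤ suc j
    length-consIfNonzero zero = m≤n⇒m≤1+n (length-nonzeroParts n j)
    length-consIfNonzero (suc x) = s≤s (length-nonzeroParts n j)

  nonzeroParts∈A : ∀ n j → j ≤ h → All (UnionA h W) (nonzeroParts n j)
  nonzeroParts∈A n zero _ = []
  nonzeroParts∈A n (suc j) 1+j≤h = consIfNonzero⁺ (classPart n (suc j)) (classPart∈A n (suc j) (s≤s z≤n) 1+j≤h) (nonzeroParts∈A n j (<⇒≤ 1+j≤h))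

  isBasis : IsAsymptoticBasis h (UnionA h W)
  isBasis = h , λ n h≤n → subst (h ⊕ UnionA h W) (parts≡n n) (refine (nonzeroParts n h) (nonzeroParts∈A n h ≤-refl) (length-nonzeroParts n h) (subst (h ≤_) (sym (parts≡n n)) h≤n))
    where
    open Refinement A≢0 splitA
    parts≡n : ∀ n → sum (nonzeroParts n h) ≡ n
    parts≡n n = trans (sum-nonzeroParts n h) (sum₁-classPart n)

∑1≡n : ∀ n → ∑[ t < n ] 1 ≡ n
∑1≡n zero = refl
∑1≡n (suc n) = cong suc (∑1≡n n)

∑-lookup : ∀ {n} (v : Vec.Vec ℕ n) → ∑[ t < n ] Vec.lookup v t ≡ Vec.sum v
∑-lookup Vec.[] = refl
∑-lookup (x Vec.∷ v) = cong (x +_) (∑-lookup v)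

≤onlyAt : ∀ {b} x k → b ≤ 1 → (b ≡ 1 → x ≡ k) → b ≤ onlyAt x 1 k
≤onlyAt x k z≤n _ = z≤n
≤onlyAt x k (s≤s z≤n) b≡1⇒x≡k = subst (λ y → 1 ≤ onlyAt y 1 k) (sym (b≡1⇒x≡k refl)) (≤-reflexive (sym (onlyAt-self k 1)))

≤1-ext : ∀ {b c} → b ≤ 1 → c ≤ 1 → (b ≡ 1 → c ≡ 1) → (c ≡ 1 → b ≡ 1) → b ≡ c
≤1-ext z≤n z≤n _ _ = refl
≤1-ext z≤n (s≤s z≤n) _ c⇒b = c⇒b refl
≤1-ext (s≤s z≤n) _ b⇒c _ = sym (b⇒c refl)

boundedChoice : ∀ {P : ℕ → ℕ → Set} h → (∀ j → j ≤ h → ∃[ u ] P j u) →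
                ∃[ R ] (∀ j → j ≤ h → ∃[ u ] (u ≤ R × P j u))
boundedChoice zero choice = proj₁ (choice 0 z≤n) , λ { zero z≤n → proj₁ (choice 0 z≤n) , ≤-refl , proj₂ (choice 0 z≤n) }
boundedChoice {P} (suc h) choice with boundedChoice h (λ j j≤h → choice j (m≤n⇒m≤1+n j≤h)) | choice (suc h) ≤-refl
... | R , chosen | u , Pu = R ⊔ u , bounded
  where
  bounded : ∀ j → j ≤ suc h → ∃[ v ] (v ≤ R ⊔ u × P j v)
  bounded j j≤1+h with j ≟ suc h
  ... | yes refl = u , m≤n⊔m R u , Pu
  ... | no j≢1+h with chosen j (≤suc∧≢⇒≤ j≤1+h j≢1+h)
  ...   | v , v≤R , Pv = v , ≤-trans v≤R (m≤m⊔n R u) , Pv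

Forces : ℕ → ℕSet → ℕ → ℕ → Set
Forces h A a n = ∀ (xs : Fin h → ℕ) → (∀ t → A (xs t)) → ∑[ t < h ] xs t ≡ n → ∃[ t ] xs t ≡ a

forcing⇒minimal : ∀ {h A} → (∀ {a} → A a → ∀ N → ∃[ n ] (N ≤ n × Forces h A a n)) →
                  ∀ B → B ⊊ A → ¬ IsAsymptoticBasis h B
forcing⇒minimal forcing B (B⊆A , a , a∈A , a∉B) (N , B-basis) =
  let (n , N≤n , forces) = forcing a∈A N
      (v , v∈B , sum≡n) = B-basis n N≤n
      (t , vₜ≡a) = forces (Vec.lookup v) (λ t → B⊆A (VAllₚ.lookup⁺ v∈B t)) (trans (∑-lookup v) sum≡n)
  in a∉B (subst B vₜ≡a (VAllₚ.lookup⁺ v∈B t))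

module Minimality {h : ℕ} (2≤h : 2 ≤ h) {W : ℕ → ℕSet}
  (cover : ∀ n → ∃[ i ] ((1 ≤ i × i ≤ h) × W i n))
  (disjoint : ∀ i j n → 1 ≤ i → i ≤ h → 1 ≤ j → j ≤ h → W i n → W j n → i ≡ j)
  (0∈W₁ : W 1 0)
  (infinite : ∀ i → 1 ≤ i → i ≤ h → Infinite (W i))
  (consecutive : ∀ i → 2 ≤ i → i ≤ h → ContainsConsecutive (clog h) (W i)) where

  open Partition cover

  class-unique : ∀ {k p} → 1 ≤ k → k ≤ h → W k p → k ≡ class p
  class-unique {k} {p} 1≤k k≤h p∈Wₖ = disjoint k (class p) p 1≤k k≤h (1≤class p) (class≤h p) p∈Wₖ (W-class p)

  RunAt : ℕ → ℕ → Set
  RunAt j u = ∀ s → s < clog h → W j (u + s)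

  another : ∀ i → ∃[ j ] (1 ≤ j × j ≤ h × j ≢ i)
  another i with i ≟ 1
  ... | yes refl = 2 , s≤s z≤n , 2≤h , (λ ())
  ... | no i≢1 = 1 , ≤-refl , ≤-trans (s≤s z≤n) 2≤h , i≢1 ∘ sym

  runBound : ∃[ R ] (∀ j → 2 ≤ j → j ≤ h → ∃[ u ] (u ≤ R × RunAt j u))
  runBound with boundedChoice {P = λ j u → 2 ≤ j → RunAt j u} h choose
    where
    choose : ∀ j → j ≤ h → ∃[ u ] (2 ≤ j → RunAt j u)
    choose j j≤h with 2 ≤? j
    ... | yes 2≤j = proj₁ (consecutive j 2≤j j≤h) , λ _ → proj₂ (consecutive j 2≤j j≤h)
    ... | no 2≰j = 0 , λ 2≤j → ⊥-elim (2≰j 2≤j)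
  ... | R , chosen = R , λ j 2≤j j≤h → let (u , u≤R , run) = chosen j j≤h in u , u≤R , run 2≤j

  module Forced {i a} (1≤i : 1 ≤ i) (i≤h : i ≤ h) (a∈Aᵢ : A⟨ W i ⟩ a) (M : ℕ) (a≤M : a ≤ M)
                (runs : ∀ j → 2 ≤ j → j ≤ h → ∃[ u ] (u + clog h ≤ M × RunAt j u)) where

    target : ℕ → ℕ
    target p with class p ≟ i
    ... | yes _ = bit p a
    ... | no _ = 1

    target≤1 : IsBitSequence target
    target≤1 p with class p ≟ i
    ... | yes _ = bit≤1 p a
    ... | no _ = ≤-refl

    n : ℕ
    n = fromIsBitSequence (suc M) target

    bit-n-in : ∀ {p} → p ≤ M → class p ≡ i → bit p n ≡ bit p a
    bit-n-in {p} p≤M class≡i with bit-fromIsBitSequence (suc M) target target≤1 p (s≤s p≤M)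
    ... | eq with class p ≟ i
    ...   | yes _ = eq
    ...   | no class≢i = ⊥-elim (class≢i class≡i)

    bit-n-out : ∀ {p} → p ≤ M → class p ≢ i → bit p n ≡ 1
    bit-n-out {p} p≤M class≢i with bit-fromIsBitSequence (suc M) target target≤1 p (s≤s p≤M)
    ... | eq with class p ≟ i
    ...   | yes class≡i = ⊥-elim (class≢i class≡i)
    ...   | no _ = eq

    bit≡1⇒≤M : ∀ {q x} → x ≤ n → bit q x ≡ 1 → q ≤ M
    bit≡1⇒≤M {q} {x} x≤n b with q ≤? M
    ... | yes q≤M = q≤M
    ... | no q≰M = ⊥-elim (<-irrefl refl (<-≤-trans (fromIsBitSequence<2^ (suc M) target target≤1)
                     (≤-trans (^-monoʳ-≤ 2 (≰⇒> q≰M)) (≤-trans (bit≡1⇒2^≤ q x b) x≤n))))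

    a-bit⇒class≡i : ∀ q → bit q a ≡ 1 → class q ≡ i
    a-bit⇒class≡i q b = sym (class-unique 1≤i i≤h (proj₂ (A⇒bits a∈Aᵢ) q b))

    a-bit⇒n-bit : ∀ q → bit q a ≡ 1 → bit q n ≡ 1
    a-bit⇒n-bit q b = trans (bit-n-in (<⇒≤ (<-≤-trans (bit≡1⇒< q a b) a≤M)) (a-bit⇒class≡i q b)) b

    module _ (xs : Fin h → ℕ) (xs∈A : ∀ t → UnionA h W (xs t)) (∑xs≡n : ∑[ t < h ] xs t ≡ n) where

      open ColumnAddition xs

      κ : Fin h → ℕ
      κ t = proj₁ (xs∈A t)

      summandBit⇒κ≡class : ∀ t q → bit q (xs t) ≡ 1 → κ t ≡ class q
      summandBit⇒κ≡class t q b with xs∈A t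
      ... | k , (1≤k , k≤h) , xₜ∈Aₖ = class-unique 1≤k k≤h (proj₂ (A⇒bits xₜ∈Aₖ) q b)

      summandBit⇒≤M : ∀ t q → bit q (xs t) ≡ 1 → q ≤ M
      summandBit⇒≤M t q = bit≡1⇒≤M (subst (xs t ≤_) ∑xs≡n (≤∑ xs t))

      bit-n≡lsb : ∀ p → bit p n ≡ lsb (colSum p + carry p)
      bit-n≡lsb p = subst (λ m → bit p m ≡ lsb (colSum p + carry p)) ∑xs≡n (bit-total p)

      summandWithBit : ∀ p → colSum p ≢ 0 → ∃[ t ] bit p (xs t) ≡ 1
      summandWithBit p colSum≢0 with ∑≢0 (λ t → bit p (xs t)) colSum≢0
      ... | t , b≢0 = t , bit≢0⇒≡1 p (xs t) b≢0

      count : ℕ → ℕ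
      count k = ∑[ t < h ] onlyAt (κ t) 1 k

      1≤κ : ∀ t → 1 ≤ κ t
      1≤κ t = proj₁ (proj₁ (proj₂ (xs∈A t)))

      κ≤h : ∀ t → κ t ≤ h
      κ≤h t = proj₂ (proj₁ (proj₂ (xs∈A t)))

      sum₁-count : sum₁ h count ≡ h
      sum₁-count = begin
        sum₁ h count                        ≡⟨ sum₁-∑ h (λ t → onlyAt (κ t) 1) ⟩
        ∑[ t < h ] sum₁ h (onlyAt (κ t) 1)  ≡⟨ sum-cong-≗ (λ t → sum₁-onlyAt h (κ t) 1 (1≤κ t) (κ≤h t)) ⟩
        ∑[ t < h ] 1                        ≡⟨ ∑1≡n h ⟩
        h                                   ∎
        where open ≡-Reasoning

      count≥1 : ∀ {j} → ∃[ t ] κ t ≡ j → 1 ≤ count j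
      count≥1 {j} (t , κt≡j) = ≤-trans (≤-reflexive (sym (subst (λ k → onlyAt k 1 j ≡ 1) (sym κt≡j) (onlyAt-self j 1))))
                                       (≤∑ (λ s → onlyAt (κ s) 1 j) t)

      1≡class0 : 1 ≡ class 0
      1≡class0 = class-unique ≤-refl (≤-trans (s≤s z≤n) 2≤h) 0∈W₁

      class₁Used : 1 ≢ i → ∃[ t ] κ t ≡ 1
      class₁Used 1≢i with summandWithBit 0 colSum₀≢0
        where
        colSum₀≢0 : colSum 0 ≢ 0
        colSum₀≢0 colSum≡0 = 0≢1+n (begin
          0                        ≡⟨ cong (λ c → lsb (c + 0)) colSum≡0 ⟨
          lsb (colSum 0 + carry 0) ≡⟨ bit-n≡lsb 0 ⟨
          bit 0 n                  ≡⟨ bit-n-out z≤n (1≢i ∘ trans 1≡class0) ⟩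
          1                        ∎)
          where open ≡-Reasoning
      ... | t , b = t , trans (summandBit⇒κ≡class t 0 b) (sym 1≡class0)

      classUsed-≥2 : ∀ j → 2 ≤ j → j ≤ h → j ≢ i → ∃[ t ] κ t ≡ j
      classUsed-≥2 j 2≤j j≤h j≢i with Finₚ.any? (λ t → κ t ≟ j) | runs j 2≤j j≤h
      ... | yes used | _ = used
      ... | no unused | u , u+L≤M , run = ⊥-elim (1+n≰n (begin
          suc h            ≤⟨ ≤2^⌈log₂⌉ (suc h) ⟩
          2 ^ clog h       ≤⟨ run⇒2^≤carry (clog h) u emptyColumns ⟩
          suc (carry u)    ≤⟨ carry< (≤-trans (s≤s z≤n) 2≤h) u ⟩
          h                ∎))
        where
        open ≤-Reasoning
        emptyColumns : ∀ s → s < clog h → colSum (u + s) ≡ 0 × bit (u + s) total ≡ 1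
        emptyColumns s s<L = ∑-0 (λ t → bit≢1⇒≡0 (u + s) (xs t) (λ b → unused (t , trans (summandBit⇒κ≡class t (u + s) b) (sym j≡class))))
                           , subst (λ m → bit (u + s) m ≡ 1) (sym ∑xs≡n) (bit-n-out u+s≤M (j≢i ∘ trans j≡class))
          where
          j≡class : j ≡ class (u + s)
          j≡class = class-unique (≤-trans (s≤s z≤n) 2≤j) j≤h (run s s<L)
          u+s≤M : u + s ≤ M
          u+s≤M = ≤-trans (+-monoʳ-≤ u (<⇒≤ s<L)) u+L≤M

      count≥1-except-i : ∀ k → 1 ≤ k → k ≤ h → k ≢ i → 1 ≤ count k
      count≥1-except-i k 1≤k k≤h k≢i with k ≟ 1
      ... | yes refl = count≥1 (class₁Used k≢i)
      ... | no k≢1 = count≥1 (classUsed-≥2 k (≤∧≢⇒< 1≤k (k≢1 ∘ sym)) k≤h k≢i)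

      count-i≤1 : count i ≤ 1
      count-i≤1 = +-cancelˡ-≤ h (count i) 1 (subst (λ s → h + count i ≤ s + 1) sum₁-count
        (sum₁-≥-except₁ h count i 1≤i i≤h count≥1-except-i))

      count≤2 : ∀ j → 1 ≤ j → j ≤ h → j ≢ i → count j ≤ 2
      count≤2 j 1≤j j≤h j≢i = m+n≤o⇒n≤o (count i) (+-cancelˡ-≤ h _ 2 (subst (λ s → h + (count i + count j) ≤ s + 2) sum₁-count
        (sum₁-≥-except₂ h count i j (j≢i ∘ sym) 1≤i i≤h 1≤j j≤h (λ k 1≤k k≤h k≢i _ → count≥1-except-i k 1≤k k≤h k≢i))))

      colSum≤count : ∀ p → colSum p ≤ count (class p)
      colSum≤count p = ∑-mono-≤ (λ t → ≤onlyAt (κ t) (class p) (bit≤1 p (xs t)) (summandBit⇒κ≡class t p))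

      colSum≤2 : ∀ p → colSum p ≤ 2
      colSum≤2 p with class p ≟ i
      ... | yes class≡i = ≤-trans (colSum≤count p) (subst (λ k → count k ≤ 2) (sym class≡i) (m≤n⇒m≤1+n count-i≤1))
      ... | no class≢i = ≤-trans (colSum≤count p) (count≤2 (class p) (1≤class p) (class≤h p) class≢i)

      -- Without an incoming carry, a column sum of 2 would put a 0 in n; but the column contains a
      -- digit of a summand, so its position is ≤ M, and it is not of class i, so n has a 1 there.
      colSum≤1 : ∀ p → carry p ≡ 0 → colSum p ≤ 1
      colSum≤1 p carry≡0 = ≤-pred (≤∧≢⇒< (colSum≤2 p) colSum≢2)
        where
        colSum≢2 : colSum p ≢ 2
        colSum≢2 colSum≡2 with summandWithBit p (λ colSum≡0 → 0≢1+n (trans (sym colSum≡0) colSum≡2))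
        ... | t , b = 0≢1+n (begin
          0                        ≡⟨ cong₂ (λ c d → lsb (c + d)) colSum≡2 carry≡0 ⟨
          lsb (colSum p + carry p) ≡⟨ bit-n≡lsb p ⟨
          bit p n                  ≡⟨ bit-n-out (summandBit⇒≤M t p b) class≢i ⟩
          1                        ∎)
          where
          open ≡-Reasoning
          class≢i : class p ≢ i
          class≢i class≡i = 1+n≰n (subst (_≤ 1) colSum≡2
            (≤-trans (colSum≤count p) (subst (λ k → count k ≤ 1) (sym class≡i) count-i≤1)))

      colSum≡bit : ∀ p → colSum p ≡ bit p n
      colSum≡bit p = subst (λ m → colSum p ≡ bit p m) ∑xs≡n (noCarry⇒colSum≡bit colSum≤1 p)

      n-bit⇒summandBit : ∀ q → bit q n ≡ 1 → ∃[ t ] bit q (xs t) ≡ 1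
      n-bit⇒summandBit q b = summandWithBit q (λ colSum≡0 → 0≢1+n (trans (sym colSum≡0) (trans (colSum≡bit q) b)))

      summandBit⇒n-bit : ∀ t q → bit q (xs t) ≡ 1 → bit q n ≡ 1
      summandBit⇒n-bit t q b = bit≢0⇒≡1 q n (λ n≡0 → 0≢1+n (sym (n≤0⇒n≡0 (begin
        1                      ≡⟨ b ⟨
        bit q (xs t)           ≤⟨ ≤∑ (λ s → bit q (xs s)) t ⟩
        colSum q               ≡⟨ colSum≡bit q ⟩
        bit q n                ≡⟨ n≡0 ⟩
        0                      ∎))))
        where open ≤-Reasoning

      κ-injective-on-i : ∀ {t t′} → κ t ≡ i → κ t′ ≡ i → t ≡ t′
      κ-injective-on-i {t} {t′} κt≡i κt′≡i with t Finₚ.≟ t′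
      ... | yes t≡t′ = t≡t′
      ... | no t≢t′ = ⊥-elim (1+n≰n (≤-trans (subst (_≤ count i) both≡1 (+≤∑ (λ s → onlyAt (κ s) 1 i) t≢t′)) count-i≤1))
        where
        at-i : ∀ {s} → κ s ≡ i → onlyAt (κ s) 1 i ≡ 1
        at-i κs≡i = subst (λ k → onlyAt k 1 i ≡ 1) (sym κs≡i) (onlyAt-self i 1)
        both≡1 : onlyAt (κ t) 1 i + onlyAt (κ t′) 1 i ≡ 2
        both≡1 = cong₂ _+_ (at-i κt≡i) (at-i κt′≡i)

      forced : ∃[ t ] xs t ≡ a
      forced with nonzero⇒bit≡1 a (proj₁ (A⇒bits a∈Aᵢ))
      ... | f , bf with n-bit⇒summandBit f (a-bit⇒n-bit f bf)
      ... | t , b = t , bit-injective (λ q → ≤1-ext (bit≤1 q (xs t)) (bit≤1 q a) (a-bit q) (summand-bit q))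
        where
        κt≡i : κ t ≡ i
        κt≡i = trans (summandBit⇒κ≡class t f b) (a-bit⇒class≡i f bf)
        a-bit : ∀ q → bit q (xs t) ≡ 1 → bit q a ≡ 1
        a-bit q bx = trans (sym (bit-n-in (summandBit⇒≤M t q bx) (trans (sym (summandBit⇒κ≡class t q bx)) κt≡i)))
                           (summandBit⇒n-bit t q bx)
        summand-bit : ∀ q → bit q a ≡ 1 → bit q (xs t) ≡ 1
        summand-bit q ba with n-bit⇒summandBit q (a-bit⇒n-bit q ba)
        ... | t′ , b′ = subst (λ s → bit q (xs s) ≡ 1) (κ-injective-on-i (trans (summandBit⇒κ≡class t′ q b′) (a-bit⇒class≡i q ba)) κt≡i) b′

  forcing : ∀ {a} → UnionA h W a → ∀ N → ∃[ n ] (N ≤ n × Forces h (UnionA h W) a n)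
  forcing {a} (i , (1≤i , i≤h) , a∈Aᵢ) N with another i | runBound
  ... | j , 1≤j , j≤h , j≢i | R , runsBelowR with infinite j 1≤j j≤h N
  ... | g , N≤g , g∈Wⱼ = n , N≤n , forced
    where
    M : ℕ
    M = a ⊔ g ⊔ (R + clog h)
    runs : ∀ k → 2 ≤ k → k ≤ h → ∃[ u ] (u + clog h ≤ M × RunAt k u)
    runs k 2≤k k≤h with runsBelowR k 2≤k k≤h
    ... | u , u≤R , run = u , ≤-trans (+-monoˡ-≤ (clog h) u≤R) (m≤n⊔m (a ⊔ g) (R + clog h)) , run
    open Forced 1≤i i≤h a∈Aᵢ M (≤-trans (m≤m⊔n a g) (m≤m⊔n (a ⊔ g) _)) runs
    N≤n : N ≤ n
    N≤n = ≤-trans N≤g (≤-trans (<⇒≤ (n<2^n g)) (bit≡1⇒2^≤ g n (bit-n-out g≤M class≢i)))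
      where
      g≤M = ≤-trans (m≤n⊔m a g) (m≤m⊔n (a ⊔ g) _)
      class≢i : class g ≢ i
      class≢i class≡i = j≢i (trans (class-unique 1≤j j≤h g∈Wⱼ) class≡i)

theorem1p2 : (h : ℕ) → 2 ≤ h → (W : ℕ → ℕSet) →
    (∀ n → ∃[ i ] ((1 ≤ i × i ≤ h) × W i n)) →
    (∀ i j n → 1 ≤ i → i ≤ h → 1 ≤ j → j ≤ h → W i n → W j n → i ≡ j) →
    (∀ i → 1 ≤ i → i ≤ h → Infinite (W i)) →
    W 1 0 →
    (∀ i → 2 ≤ i → i ≤ h → ContainsConsecutive (clog h) (W i)) →
    IsMinimalAsymptoticBasis h (UnionA h W)
theorem1p2 h 2≤h W cover disjoint infinite 0∈W₁ consecutive =
  Partition.isBasis cover , forcing⇒minimal (Minimality.forcing 2≤h cover disjoint 0∈W₁ infinite consecutive)
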